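{- Let $f,g,r,r',N,S\in\mathbb{Z}[x]$ with $f,g,r,r',N$ nonzero, $(Sf+r)(Sg+r')=N$, $\deg(r),\deg(r')<\deg(S)$, and $3\deg(S)\ge\deg(N)$. Then $\deg(f)+\deg(g)\le\deg(S)$. In particular $\deg(f),\deg(g)\le\deg(S)$. -}

module Defs where

-- Univariate polynomials over ℤ, represented by little-endian coefficient
-- lists (index i holds the coefficient of x^i). Trailing zeros are allowed;
-- equality of polynomials is coefficientwise and the degree ignores them.

open import Data.Nat using (ℕ; zero; suc; _∸_)
open import Data.Integer using (ℤ; 0ℤ; _+_; _*_)
open import Data.Integer.Properties using (_≟_)
open import Data.List using (List; []; _∷_; map; length)
open import Relation.Nullary using (¬_; yes; no)
open import Relation.Binary.PropositionalEquality using (_≡_)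

Poly : Set
Poly = List ℤ

coeff : Poly → ℕ → ℤ
coeff []      _       = 0ℤ
coeff (a ∷ p) zero    = a
coeff (a ∷ p) (suc i) = coeff p i

infix 4 _≈ₚ_
_≈ₚ_ : Poly → Poly → Set
p ≈ₚ q = ∀ i → coeff p i ≡ coeff q i

0ₚ : Poly
0ₚ = []

infixl 6 _+ₚ_
_+ₚ_ : Poly → Poly → Poly
[]      +ₚ q       = q
(a ∷ p) +ₚ []      = a ∷ p
(a ∷ p) +ₚ (b ∷ q) = (a + b) ∷ (p +ₚ q)

infixl 7 _*ₚ_
_*ₚ_ : Poly → Poly → Poly
[]      *ₚ q = []
(a ∷ p) *ₚ q = map (a *_) q +ₚ (0ℤ ∷ (p *ₚ q))

trim : Poly → Poly
trim [] = []
trim (a ∷ p) with trim p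
... | b ∷ q = a ∷ b ∷ q
... | [] with a ≟ 0ℤ
...   | yes _ = []
...   | no  _ = a ∷ []

-- degree: index of the leading nonzero coefficient (deg 0 := 0; only
-- used for nonzero polynomials in the statement, except possibly S)
deg : Poly → ℕ
deg p = length (trim p) ∸ 1

module Submission where

-- Comparing top coefficients: with s = deg S ≥ 1 (forced by deg r < deg S), the
-- terms r, r′ lie strictly below deg (S f) and deg (S g), so S f + r and S g + r′
-- have degrees s + deg f and s + deg g with nonzero leading coefficients. Since ℤ
-- has no zero divisors, deg N = (s + deg f) + (s + deg g), and deg N ≤ 3 s gives
-- deg f + deg g ≤ s.

open import Defs
open import Data.Nat using (ℕ; zero; suc; _+_; _*_; _∸_; _≤_; _<_; z≤n; s≤s)
open import Data.Nat.Properties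
  using (≤-trans; ≤-antisym; ≮⇒≥; <⇒≤; <-trans; <-≤-trans; ≤-<-trans; <-irrefl; m≤m+n; m≤n+m; +-cancelˡ-≤)
open import Data.Integer using (0ℤ) renaming (_+_ to _+ℤ_; _*_ to _*ℤ_)
open import Data.Integer.Properties as ℤ
  using (+-identityˡ; +-identityʳ; *-zeroʳ; i*j≡0⇒i≡0∨j≡0)
open import Data.List using ([]; _∷_; map; length)
open import Data.Product using (_×_; _,_; proj₂)
open import Data.Sum using (_⊎_; inj₁; inj₂)
open import Data.Empty using (⊥-elim)
open import Relation.Nullary using (¬_; yes; no)
open import Relation.Binary.PropositionalEquality
open import Data.Nat.Tactic.RingSolver using (solve)

VanishesAbove : Poly → ℕ → Set
VanishesAbove p d = ∀ i → d < i → coeff p i ≡ 0ℤ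

HasDegree : Poly → ℕ → Set
HasDegree p d = VanishesAbove p d × coeff p d ≢ 0ℤ

≈ₚ-hasDegree : ∀ p q {d} → p ≈ₚ q → HasDegree p d → HasDegree q d
≈ₚ-hasDegree p q p≈q (v , lead≢0) =
  (λ i d<i → trans (sym (p≈q i)) (v i d<i)) , λ e → lead≢0 (trans (p≈q _) e)

coeff-trim : ∀ p i → coeff (trim p) i ≡ coeff p i
coeff-trim [] i = refl
coeff-trim (a ∷ p) i with trim p | coeff-trim p
... | b ∷ q | ih with i
...   | zero  = refl
...   | suc i = ih i
coeff-trim (a ∷ p) i | [] | ih with a ℤ.≟ 0ℤ
... | yes a≡0 with i
...   | zero  = sym a≡0
...   | suc i = ih i
coeff-trim (a ∷ p) i | [] | ih | no _ with i
...   | zero  = refl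
...   | suc i = ih i

trim-last≢0 : ∀ p → trim p ≡ [] ⊎ coeff (trim p) (length (trim p) ∸ 1) ≢ 0ℤ
trim-last≢0 [] = inj₁ refl
trim-last≢0 (a ∷ p) with trim p | trim-last≢0 p
... | b ∷ q | inj₁ ()
... | b ∷ q | inj₂ last≢0 = inj₂ last≢0
... | [] | _ with a ℤ.≟ 0ℤ
...   | yes _   = inj₁ refl
...   | no a≢0 = inj₂ a≢0

coeff-≥length : ∀ t i → length t ≤ i → coeff t i ≡ 0ℤ
coeff-≥length [] i _ = refl
coeff-≥length (a ∷ t) (suc i) (s≤s le) = coeff-≥length t i le

vanishesAbove-deg : ∀ p → VanishesAbove p (deg p)
vanishesAbove-deg p i deg<i =
  trans (sym (coeff-trim p i)) (coeff-≥length (trim p) i (length≤ (length (trim p)) deg<i))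
  where
  length≤ : ∀ m → m ∸ 1 < i → m ≤ i
  length≤ zero    _ = z≤n
  length≤ (suc m) h = h

trim≡[]⇒≈0 : ∀ p → trim p ≡ [] → p ≈ₚ 0ₚ
trim≡[]⇒≈0 p e i = trans (sym (coeff-trim p i)) (cong (λ t → coeff t i) e)

hasDegree-deg : ∀ p → trim p ≢ [] → HasDegree p (deg p)
hasDegree-deg p trim≢[] with trim-last≢0 p
... | inj₁ e       = ⊥-elim (trim≢[] e)
... | inj₂ last≢0 = vanishesAbove-deg p , λ e → last≢0 (trans (coeff-trim p (deg p)) e)

≉0⇒trim≢[] : ∀ p → ¬ (p ≈ₚ 0ₚ) → trim p ≢ []
≉0⇒trim≢[] p p≉0 e = p≉0 (trim≡[]⇒≈0 p e)

deg>0⇒trim≢[] : ∀ p → 0 < deg p → trim p ≢ []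
deg>0⇒trim≢[] p 0<deg e = <-irrefl refl (subst (λ t → 0 < length t ∸ 1) e 0<deg)

hasDegree⇒deg≡ : ∀ p {d} → HasDegree p d → deg p ≡ d
hasDegree⇒deg≡ p {d} (v , lead≢0) = ≤-antisym
  (≮⇒≥ λ d<deg → proj₂ (hasDegree-deg p (≉0⇒trim≢[] p λ p≈0 → lead≢0 (p≈0 d)))
                        (v (deg p) d<deg))
  (≮⇒≥ λ deg<d → lead≢0 (vanishesAbove-deg p d deg<d))

coeff-+ₚ : ∀ p q i → coeff (p +ₚ q) i ≡ coeff p i +ℤ coeff q i
coeff-+ₚ [] q i = sym (+-identityˡ _)
coeff-+ₚ (a ∷ p) [] i = sym (+-identityʳ _)
coeff-+ₚ (a ∷ p) (b ∷ q) zero = refl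
coeff-+ₚ (a ∷ p) (b ∷ q) (suc i) = coeff-+ₚ p q i

coeff-map-* : ∀ a q i → coeff (map (a *ℤ_) q) i ≡ a *ℤ coeff q i
coeff-map-* a [] i = sym (*-zeroʳ a)
coeff-map-* a (b ∷ q) zero = refl
coeff-map-* a (b ∷ q) (suc i) = coeff-map-* a q i

coeff-∷-*ₚ : ∀ a p q i → coeff ((a ∷ p) *ₚ q) i ≡ a *ℤ coeff q i +ℤ coeff (0ℤ ∷ p *ₚ q) i
coeff-∷-*ₚ a p q i =
  trans (coeff-+ₚ (map (a *ℤ_) q) (0ℤ ∷ p *ₚ q) i)
        (cong (_+ℤ coeff (0ℤ ∷ p *ₚ q) i) (coeff-map-* a q i))

0∷-≈0 : ∀ {t} → t ≈ₚ 0ₚ → (0ℤ ∷ t) ≈ₚ 0ₚ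
0∷-≈0 _   zero    = refl
0∷-≈0 t≈0 (suc i) = t≈0 i

*ₚ-zeroˡ : ∀ p q → p ≈ₚ 0ₚ → p *ₚ q ≈ₚ 0ₚ
*ₚ-zeroˡ [] q _ i = refl
*ₚ-zeroˡ (a ∷ p) q a∷p≈0 i = begin
  coeff ((a ∷ p) *ₚ q) i                  ≡⟨ coeff-∷-*ₚ a p q i ⟩
  a *ℤ coeff q i +ℤ coeff (0ℤ ∷ p *ₚ q) i ≡⟨ cong₂ _+ℤ_ (cong (_*ℤ coeff q i) (a∷p≈0 0))
                                                        (0∷-≈0 (*ₚ-zeroˡ p q (λ j → a∷p≈0 (suc j))) i) ⟩
  0ℤ                                      ∎
  where open ≡-Reasoning

constant-*ₚ : ∀ a p q → p ≈ₚ 0ₚ → ∀ i → coeff ((a ∷ p) *ₚ q) i ≡ a *ℤ coeff q i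
constant-*ₚ a p q p≈0 i =
  trans (coeff-∷-*ₚ a p q i)
        (trans (cong (a *ℤ coeff q i +ℤ_) (0∷-≈0 (*ₚ-zeroˡ p q p≈0) i)) (+-identityʳ _))

tail-vanishesAbove : ∀ {a p m} → VanishesAbove (a ∷ p) (suc m) → VanishesAbove p m
tail-vanishesAbove v i m<i = v (suc i) (s≤s m<i)

constant⇒tail≈0 : ∀ {a p} → VanishesAbove (a ∷ p) 0 → p ≈ₚ 0ₚ
constant⇒tail≈0 v j = v (suc j) (s≤s z≤n)

*ₚ-vanishesAbove : ∀ p q m n → VanishesAbove p m → VanishesAbove q n →
                   VanishesAbove (p *ₚ q) (m + n)
*ₚ-vanishesAbove [] q m n _ _ i _ = refl
*ₚ-vanishesAbove (a ∷ p) q zero n vp vq i n<i =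
  trans (constant-*ₚ a p q (constant⇒tail≈0 vp) i)
        (trans (cong (a *ℤ_) (vq i n<i)) (*-zeroʳ a))
*ₚ-vanishesAbove (a ∷ p) q (suc m) n vp vq (suc i) (s≤s m+n<i) =
  trans (coeff-∷-*ₚ a p q (suc i))
        (cong₂ _+ℤ_ (trans (cong (a *ℤ_) (vq (suc i) (s≤s (≤-trans (m≤n+m n m) (<⇒≤ m+n<i)))))
                           (*-zeroʳ a))
                    (*ₚ-vanishesAbove p q m n (tail-vanishesAbove vp) vq i m+n<i))

coeff-*ₚ-top : ∀ p q m n → VanishesAbove p m → VanishesAbove q n →
               coeff (p *ₚ q) (m + n) ≡ coeff p m *ℤ coeff q n
coeff-*ₚ-top [] q m n _ _ = refl
coeff-*ₚ-top (a ∷ p) q zero n vp vq = constant-*ₚ a p q (constant⇒tail≈0 vp) n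
coeff-*ₚ-top (a ∷ p) q (suc m) n vp vq =
  trans (coeff-∷-*ₚ a p q (suc (m + n)))
        (trans (cong₂ _+ℤ_ (trans (cong (a *ℤ_) (vq (suc (m + n)) (s≤s (m≤n+m n m)))) (*-zeroʳ a))
                           (coeff-*ₚ-top p q m n (tail-vanishesAbove vp) vq))
               (+-identityˡ _))

*ₚ-hasDegree : ∀ p q {m n} → HasDegree p m → HasDegree q n → HasDegree (p *ₚ q) (m + n)
*ₚ-hasDegree p q {m} {n} (vp , p≢0) (vq , q≢0) =
  *ₚ-vanishesAbove p q m n vp vq , λ e → no-zero-divisors (trans (sym (coeff-*ₚ-top p q m n vp vq)) e)
  where
  no-zero-divisors : coeff p m *ℤ coeff q n ≢ 0ℤ
  no-zero-divisors e with i*j≡0⇒i≡0∨j≡0 (coeff p m) e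
  ... | inj₁ p≡0 = p≢0 p≡0
  ... | inj₂ q≡0 = q≢0 q≡0

+ₚ-hasDegree-lowerʳ : ∀ p q {d e} → HasDegree p d → VanishesAbove q e → e < d →
                      HasDegree (p +ₚ q) d
+ₚ-hasDegree-lowerʳ p q {d} (vp , p≢0) vq e<d =
  (λ i d<i → trans (coeff-+ₚ p q i) (cong₂ _+ℤ_ (vp i d<i) (vq i (<-trans e<d d<i))))
  , λ sum≡0 → p≢0 (begin
      coeff p d              ≡⟨ sym (+-identityʳ _) ⟩
      coeff p d +ℤ 0ℤ        ≡⟨ cong (coeff p d +ℤ_) (sym (vq d e<d)) ⟩
      coeff p d +ℤ coeff q d ≡⟨ sym (coeff-+ₚ p q d) ⟩
      coeff (p +ₚ q) d       ≡⟨ sum≡0 ⟩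
      0ℤ                     ∎)
  where open ≡-Reasoning

perturbed-hasDegree : ∀ S f r → 0 < deg S → ¬ (f ≈ₚ 0ₚ) → deg r < deg S →
                      HasDegree (S *ₚ f +ₚ r) (deg S + deg f)
perturbed-hasDegree S f r 0<degS f≉0 degr<degS =
  +ₚ-hasDegree-lowerʳ (S *ₚ f) r
    (*ₚ-hasDegree S f (hasDegree-deg S (deg>0⇒trim≢[] S 0<degS))
                      (hasDegree-deg f (≉0⇒trim≢[] f f≉0)))
    (vanishesAbove-deg r)
    (<-≤-trans degr<degS (m≤m+n (deg S) (deg f)))

sum-bound : ∀ s a b → (s + a) + (s + b) ≤ 3 * s → a + b ≤ s
sum-bound s a b h = +-cancelˡ-≤ (s + s) (a + b) s (subst₂ _≤_ regroup triple h)
  where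
  regroup : (s + a) + (s + b) ≡ (s + s) + (a + b)
  regroup = solve (s ∷ a ∷ b ∷ [])
  triple : 3 * s ≡ (s + s) + s
  triple = solve (s ∷ [])

lemma3p3 : (f g r r′ N S : Poly) →
    ¬ (f ≈ₚ 0ₚ) → ¬ (g ≈ₚ 0ₚ) → ¬ (r ≈ₚ 0ₚ) → ¬ (r′ ≈ₚ 0ₚ) → ¬ (N ≈ₚ 0ₚ) →
    (S *ₚ f +ₚ r) *ₚ (S *ₚ g +ₚ r′) ≈ₚ N →
    deg r < deg S → deg r′ < deg S → deg N ≤ 3 * deg S →
    (deg f + deg g ≤ deg S) × (deg f ≤ deg S) × (deg g ≤ deg S)
lemma3p3 f g r r′ N S f≉0 g≉0 _ _ _ product≈N degr<degS degr′<degS degN≤3degS =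
  f+g≤S , ≤-trans (m≤m+n (deg f) (deg g)) f+g≤S , ≤-trans (m≤n+m (deg g) (deg f)) f+g≤S
  where
  Sf+r Sg+r′ : Poly
  Sf+r  = S *ₚ f +ₚ r
  Sg+r′ = S *ₚ g +ₚ r′
  0<degS : 0 < deg S
  0<degS = ≤-<-trans z≤n degr<degS
  degN≡ : deg N ≡ (deg S + deg f) + (deg S + deg g)
  degN≡ = hasDegree⇒deg≡ N (≈ₚ-hasDegree (Sf+r *ₚ Sg+r′) N product≈N
    (*ₚ-hasDegree Sf+r Sg+r′ (perturbed-hasDegree S f r 0<degS f≉0 degr<degS)
                             (perturbed-hasDegree S g r′ 0<degS g≉0 degr′<degS)))
  f+g≤S : deg f + deg g ≤ deg S
  f+g≤S = sum-bound (deg S) (deg f) (deg g) (subst (_≤ 3 * deg S) degN≡ degN≤3degS)
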